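{- Let $G=(V,E)$ be a directed graph, $k\ge 7$ a fixed integer, and let $\mathcal{C}$, $G_1$, $M$, $G_2$ and $G_3$ be constructed from $G$ as described in the context. Then for each connected component $H$ of $G_3$: (1) $H$ is an isolated vertex or a star; (2) if $H$ has at least three vertices, then every satellite of $H$ corresponds to a $2$-cycle of $\mathcal{C}$; (3) if $H$ has exactly two vertices, then at least one vertex of $H$ corresponds to a $2$-cycle of $\mathcal{C}$.
   Context: Graphs are directed without self-loops or multiple edges. A path-cycle cover of a directed graph $H$ is a spanning subgraph of $H$ in which every vertex has in-degree at most $1$ and out-degree at most $1$; its connected components are vertex-disjoint directed paths (possibly single vertices) and directed cycles. A maximum path-cycle cover is one with the maximum number of edges. $d^+_{\mathcal{C}}(v)$, $d^-_{\mathcal{C}}(v)$ denote out- and in-degree in $\mathcal{C}$. Construction: (i) compute a maximum path-cycle cover $\mathcal{C}$ of $G$; (ii) while there is an edge $(u,v)\in E(G)\setminus E(\mathcal{C})$ such that $d^+_{\mathcal{C}}(u)=0$ and $v$ lies on a cycle of $\mathcal{C}$ (respectively, $d^-_{\mathcal{C}}(v)=0$ and $u$ lies on a cycle of $\mathcal{C}$), replace the edge of $\mathcal{C}$ entering $v$ (respectively, leaving $u$) by $(u,v)$; call the result $\mathcal{C}$. A $2$-cycle is a cycle component of $\mathcal{C}$ with two vertices. (iii) $G_1=(V,E_1)$ where $E_1$ is the set of edges $(u,v)\in E(G)\setminus E(\mathcal{C})$ with $u,v$ in different components of $\mathcal{C}$, at least one of which is a $2$-cycle. A subgraph $S$ of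 $G_1$ saturates a $2$-cycle $D$ of $\mathcal{C}$ if some edge of $S$ is incident to a vertex of $D$; the weight of $S$ is the number of $2$-cycles of $\mathcal{C}$ it saturates. (iv) Let $M$ be a maximum-weight path-cycle cover of $G_1$; while some edge $e$ of $M$ can be removed without changing the weight of $M$, delete $e$ from $M$. (v) $G_2=(V,E(\mathcal{C})\cup E(M))$. (vi) $G_3$ is the undirected graph whose vertices correspond one-to-one to the connected components of $\mathcal{C}$, two vertices being adjacent iff there is an edge of $G_2$ between the corresponding components. An undirected graph is a star if it is connected, has at least one edge, and all but at most one vertex have degree $1$; its center is the vertex of degree larger than $1$ if there is one, and otherwise (the star is a single edge) one of its two vertices; the other vertices are satellites. A vertex is isolated if it has degree $0$. -}

module Defs where

open import Data.Nat using (ℕ; zero; suc; _+_; _≤_; _<ᵇ_)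
open import Data.Fin using (Fin; zero; suc; toℕ; _≟_)
open import Data.Bool using (Bool; true; false; _∧_; _∨_; not; if_then_else_)
open import Data.Product using (Σ; _×_; ∃)
open import Data.Sum using (_⊎_)
open import Data.Empty using (⊥)
open import Relation.Nullary using (¬_)
open import Relation.Nullary.Decidable using (⌊_⌋)
open import Relation.Binary.PropositionalEquality using (_≡_)
open import Relation.Binary.Construct.Closure.Transitive using (TransClosure)
open import Relation.Binary.Construct.Closure.ReflexiveTransitive using (Star)

-- A directed graph (or edge set of a spanning subgraph) on vertex set Fin n,
-- given by its Boolean adjacency matrix: (u , v) is an edge iff A u v ≡ true.
Digraph : ℕ → Set
Digraph n = Fin n → Fin n → Bool

Loopless : ∀ {n} → Digraph n → Set
Loopless {n} G = (v : Fin n) → G v v ≡ false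

sumF : ∀ {n} → (Fin n → ℕ) → ℕ
sumF {zero} f = 0
sumF {suc n} f = f zero + sumF (λ i → f (suc i))

countF : ∀ {n} → (Fin n → Bool) → ℕ
countF p = sumF (λ i → if p i then 1 else 0)

anyF : ∀ {n} → (Fin n → Bool) → Bool
anyF {zero} p = false
anyF {suc n} p = p zero ∨ anyF (λ i → p (suc i))

_==_ : ∀ {n} → Fin n → Fin n → Bool
a == b = ⌊ a ≟ b ⌋

module _ {n : ℕ} where

  edges : Digraph n → ℕ
  edges A = sumF (λ u → countF (A u))

  outdeg indeg : Digraph n → Fin n → ℕ
  outdeg A u = countF (A u)
  indeg A v = countF (λ u → A u v)

  IsPCC : (H : Fin n → Fin n → Set) → Digraph n → Set
  IsPCC H C = ((u v : Fin n) → C u v ≡ true → H u v)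
            × ((v : Fin n) → outdeg C v ≤ 1)
            × ((v : Fin n) → indeg C v ≤ 1)

  EdgeOf : Digraph n → Fin n → Fin n → Set
  EdgeOf G u v = G u v ≡ true

  IsMaxPCC : Digraph n → Digraph n → Set
  IsMaxPCC G C = IsPCC (EdgeOf G) C
               × ((C' : Digraph n) → IsPCC (EdgeOf G) C' → edges C' ≤ edges C)

  OnCycle : Digraph n → Fin n → Set
  OnCycle C v = TransClosure (λ a b → C a b ≡ true) v v

  replace : Digraph n → (a b c d : Fin n) → Digraph n
  replace C a b c d x y = (C x y ∧ not ((a == x) ∧ (b == y))) ∨ ((c == x) ∧ (d == y))

  remove : Digraph n → (a b : Fin n) → Digraph n
  remove M a b x y = M x y ∧ not ((a == x) ∧ (b == y))

  _≗₂_ : Digraph n → Digraph n → Set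
  A ≗₂ B = (x y : Fin n) → A x y ≡ B x y

  data CStep (G : Digraph n) (C C' : Digraph n) : Set where
    fwd : (u v w : Fin n) → G u v ≡ true → C u v ≡ false → outdeg C u ≡ 0 →
          OnCycle C v → C w v ≡ true → C' ≗₂ replace C w v u v → CStep G C C'
    bwd : (u v w : Fin n) → G u v ≡ true → C u v ≡ false → indeg C v ≡ 0 →
          OnCycle C u → C u w ≡ true → C' ≗₂ replace C u w u v → CStep G C C'

  IsFinalCover : Digraph n → Digraph n → Set
  IsFinalCover G C = Σ (Digraph n) (λ C₀ → IsMaxPCC G C₀ × Star (CStep G) C₀ C)
                   × ((C' : Digraph n) → ¬ CStep G C C')

  SameComp : Digraph n → Fin n → Fin n → Set
  SameComp C = Star (λ a b → (C a b ≡ true) ⊎ (C b a ≡ true))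

  -- the component of C containing x is a 2-cycle
  In2Cycle : Digraph n → Fin n → Set
  In2Cycle C x = Σ (Fin n) (λ y → (C x y ≡ true) × (C y x ≡ true))

  E1 : Digraph n → Digraph n → Fin n → Fin n → Set
  E1 G C u v = (G u v ≡ true) × (C u v ≡ false) × ¬ SameComp C u v
             × (In2Cycle C u ⊎ In2Cycle C v)

  -- weight of S: number of 2-cycles of C saturated by S; each 2-cycle {x,y}
  -- is counted once, through its vertex x with the smaller index.
  incident : Digraph n → Fin n → Bool
  incident S x = anyF (λ z → S x z ∨ S z x)

  weight : Digraph n → Digraph n → ℕ
  weight C S = countF (λ x → anyF (λ y →
      C x y ∧ C y x ∧ (toℕ x <ᵇ toℕ y) ∧ (incident S x ∨ incident S y)))

  IsMaxWeightPCC : Digraph n → Digraph n → Digraph n → Set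
  IsMaxWeightPCC G C M = IsPCC (E1 G C) M
      × ((M' : Digraph n) → IsPCC (E1 G C) M' → weight C M' ≤ weight C M)

  data MStep (C : Digraph n) (M M' : Digraph n) : Set where
    prune : (a b : Fin n) → M a b ≡ true → M' ≗₂ remove M a b →
            weight C M' ≡ weight C M → MStep C M M'

  IsFinalM : Digraph n → Digraph n → Digraph n → Set
  IsFinalM G C M = Σ (Digraph n) (λ M₀ → IsMaxWeightPCC G C M₀ × Star (MStep C) M₀ M)
                 × ((M' : Digraph n) → ¬ MStep C M M')

  G2 : Digraph n → Digraph n → Digraph n
  G2 C M x y = C x y ∨ M x y

  -- G₃: vertices are components of C, represented by their vertices;
  -- Adj3 a b: the components of a and b are distinct and some edge of G₂
  -- joins them.
  Adj3 : Digraph n → Digraph n → Fin n → Fin n → Set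
  Adj3 C M a b = ¬ SameComp C a b ×
    Σ (Fin n) (λ x → Σ (Fin n) (λ y → SameComp C a x × SameComp C b y
       × ((G2 C M x y ≡ true) ⊎ (G2 C M y x ≡ true))))

  Conn3 : Digraph n → Digraph n → Fin n → Fin n → Set
  Conn3 C M = Star (λ a b → SameComp C a b ⊎ Adj3 C M a b)

  Deg0 : Digraph n → Digraph n → Fin n → Set
  Deg0 C M v = (w : Fin n) → ¬ Adj3 C M v w

  Deg1 : Digraph n → Digraph n → Fin n → Set
  Deg1 C M v = Σ (Fin n) (λ w → Adj3 C M v w)
             × ((w w' : Fin n) → Adj3 C M v w → Adj3 C M v w' → SameComp C w w')

  -- the component H of G₃ containing (the component of) r:
  -- H is an isolated vertex
  IsolatedH : Digraph n → Digraph n → Fin n → Set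
  IsolatedH C M r = Deg0 C M r

  -- H is a star: connected (automatic), has an edge, and all vertices but at
  -- most one (the center c) have degree 1
  StarH : Digraph n → Digraph n → Fin n → Set
  StarH C M r =
      Σ (Fin n) (λ a → Σ (Fin n) (λ b → Conn3 C M r a × Adj3 C M a b))
    × Σ (Fin n) (λ c → Conn3 C M r c ×
         ((v : Fin n) → Conn3 C M r v → ¬ SameComp C v c → Deg1 C M v))

  AtLeast3H : Digraph n → Digraph n → Fin n → Set
  AtLeast3H C M r = Σ (Fin n) (λ a → Σ (Fin n) (λ b → Σ (Fin n) (λ c →
      Conn3 C M r a × Conn3 C M r b × Conn3 C M r c
    × ¬ SameComp C a b × ¬ SameComp C a c × ¬ SameComp C b c)))

  Exactly2H : Digraph n → Digraph n → Fin n → Fin n → Fin n → Set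
  Exactly2H C M r a b = Conn3 C M r a × Conn3 C M r b × ¬ SameComp C a b
    × ((v : Fin n) → Conn3 C M r v → SameComp C v a ⊎ SameComp C v b)

-- Every edge of the pruned M is essential for the weight, so deleting it
-- unsaturates some 2-cycle of C, which therefore meets M in that edge only.
-- Consequently every edge of G₃ has an endpoint that is a 2-cycle whose only
-- neighbour in G₃ is the other endpoint. A connected graph in which every edge
-- has such a pendant endpoint is a star, an edge or a point, and its satellites
-- are pendant 2-cycles.
module Submission where

open import Defs
open import Data.Nat using (ℕ; zero; suc; _≤_; _<_; z≤n; s≤s; _+_)
open import Data.Nat.Properties
  using (≤-refl; ≤-trans; <-≤-trans; m≤n+m; n≮n; 1+n≰n; +-mono-≤; +-mono-<-≤; +-mono-≤-<)
open import Data.Fin using (Fin; zero; suc)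
open import Data.Fin.Properties using (any?; ¬∀⟶∃¬)
open import Data.Bool using (Bool; true; false; _∧_; _∨_; not; if_then_else_)
open import Data.Bool.Properties
  using (T-≡; ¬-not; ∨-zeroʳ; ∨-conicalˡ; ∨-conicalʳ) renaming (_≟_ to _≟ᵇ_)
open import Data.Product as Prod using (∃-syntax; _×_; _,_; proj₁; proj₂)
open import Data.Sum as Sum using (_⊎_; inj₁; inj₂; [_,_]′)
open import Data.Empty using (⊥; ⊥-elim)
open import Function using (_∘_)
open import Function.Bundles using (Equivalence)
open import Relation.Nullary using (¬_; Dec; yes; no; contradiction)
open import Relation.Nullary.Decidable using (toWitness; fromWitness; _×-dec_; _⊎-dec_)
open import Relation.Binary.PropositionalEquality using (_≡_; _≢_; refl; sym; trans; cong; cong₂; subst)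
open import Relation.Binary.Construct.Closure.ReflexiveTransitive
  using (Star; ε; _◅_; _◅◅_; reverse) renaming (map to Star-map)

∨-true⁻ : ∀ {a b} → a ∨ b ≡ true → a ≡ true ⊎ b ≡ true
∨-true⁻ {true}  _ = inj₁ refl
∨-true⁻ {false} e = inj₂ e

∨-trueˡ : ∀ {a} b → a ≡ true → a ∨ b ≡ true
∨-trueˡ b refl = refl

∨-trueʳ : ∀ a {b} → b ≡ true → a ∨ b ≡ true
∨-trueʳ a refl = ∨-zeroʳ a

∧-true⁻ˡ : ∀ {a b} → a ∧ b ≡ true → a ≡ true
∧-true⁻ˡ {true} _ = refl

∧-true⁻ʳ : ∀ {a b} → a ∧ b ≡ true → b ≡ true
∧-true⁻ʳ {true} e = e

¬-not-true : ∀ {a} → not a ≡ true → a ≢ true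
¬-not-true {false} _ ()

∧-intro : ∀ {a b} → a ≡ true → b ≡ true → a ∧ b ≡ true
∧-intro refl refl = refl

∧-≢⇒true×≢ : ∀ a {b c} → a ∧ b ≢ a ∧ c → a ≡ true × b ≢ c
∧-≢⇒true×≢ true  ne = refl , ne
∧-≢⇒true×≢ false ne = contradiction refl ne

⇒-≢⇒false×true : ∀ {a b} → (a ≡ true → b ≡ true) → a ≢ b → a ≡ false × b ≡ true
⇒-≢⇒false×true {true}  {true}  _ ne = contradiction refl ne
⇒-≢⇒false×true {true}  {false} h _  = contradiction (h refl) λ ()
⇒-≢⇒false×true {false} {true}  _ _  = refl , refl
⇒-≢⇒false×true {false} {false} _ ne = contradiction refl ne

==⇒≡ : ∀ {n} {a b : Fin n} → (a == b) ≡ true → a ≡ b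
==⇒≡ e = toWitness (Equivalence.from T-≡ e)

≡⇒== : ∀ {n} {a b : Fin n} → a ≡ b → (a == b) ≡ true
≡⇒== p = Equivalence.to T-≡ (fromWitness p)

indicator : Bool → ℕ
indicator b = if b then 1 else 0

indicator-mono : ∀ {a b} → (a ≡ true → b ≡ true) → indicator a ≤ indicator b
indicator-mono {false} _ = z≤n
indicator-mono {true}  h rewrite h refl = ≤-refl

indicator≤1 : ∀ b → indicator b ≤ 1
indicator≤1 true  = ≤-refl
indicator≤1 false = z≤n

sumF-cong : ∀ {n} {f g : Fin n → ℕ} → (∀ i → f i ≡ g i) → sumF f ≡ sumF g
sumF-cong {zero}  _  = refl
sumF-cong {suc n} eq = cong₂ _+_ (eq zero) (sumF-cong (eq ∘ suc))

countF-≢⇒∃≢ : ∀ {n} {p q : Fin n → Bool} → countF p ≢ countF q → ∃[ i ] p i ≢ q i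
countF-≢⇒∃≢ {n} {p} {q} ne =
  ¬∀⟶∃¬ n _ (λ i → p i ≟ᵇ q i) (ne ∘ sumF-cong ∘ λ eq i → cong indicator (eq i))

anyF-cong : ∀ {n} {p q : Fin n → Bool} → (∀ i → p i ≡ q i) → anyF p ≡ anyF q
anyF-cong {zero}  _  = refl
anyF-cong {suc n} eq = cong₂ _∨_ (eq zero) (anyF-cong (eq ∘ suc))

anyF-≢⇒∃≢ : ∀ {n} {p q : Fin n → Bool} → anyF p ≢ anyF q → ∃[ i ] p i ≢ q i
anyF-≢⇒∃≢ {n} {p} {q} ne = ¬∀⟶∃¬ n _ (λ i → p i ≟ᵇ q i) (ne ∘ anyF-cong)

anyF-true⇒∃ : ∀ {n} (p : Fin n → Bool) → anyF p ≡ true → ∃[ i ] p i ≡ true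
anyF-true⇒∃ {suc n} p e with ∨-true⁻ {p zero} e
... | inj₁ e₀ = zero , e₀
... | inj₂ e₁ = let (i , eᵢ) = anyF-true⇒∃ (p ∘ suc) e₁ in suc i , eᵢ

anyF-intro : ∀ {n} (p : Fin n → Bool) i → p i ≡ true → anyF p ≡ true
anyF-intro p zero    e = ∨-trueˡ _ e
anyF-intro p (suc i) e = ∨-trueʳ (p zero) (anyF-intro (p ∘ suc) i e)

anyF-false⇒ : ∀ {n} (p : Fin n → Bool) → anyF p ≡ false → ∀ i → p i ≡ false
anyF-false⇒ p e i with p i in eq
... | false = refl
... | true  = contradiction (trans (sym e) (anyF-intro p i eq)) λ ()

countF-mono : ∀ {n} {p q : Fin n → Bool} → (∀ i → p i ≡ true → q i ≡ true) → countF p ≤ countF q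
countF-mono {zero}  _   = z≤n
countF-mono {suc n} sub = +-mono-≤ (indicator-mono (sub zero)) (countF-mono (sub ∘ suc))

countF-mono-< : ∀ {n} {p q : Fin n → Bool} → (∀ i → p i ≡ true → q i ≡ true) →
                ∀ j → p j ≡ false → q j ≡ true → countF p < countF q
countF-mono-< sub zero pj qj rewrite pj | qj =
  +-mono-<-≤ (s≤s z≤n) (countF-mono (sub ∘ suc))
countF-mono-< sub (suc j) pj qj =
  +-mono-≤-< (indicator-mono (sub zero)) (countF-mono-< (sub ∘ suc) j pj qj)

countF-pos : ∀ {n} (p : Fin n → Bool) j → p j ≡ true → 0 < countF p
countF-pos p zero    e rewrite e = s≤s z≤n
countF-pos p (suc j) e = <-≤-trans (countF-pos (p ∘ suc) j e) (m≤n+m _ _)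

countF≤n : ∀ {n} (p : Fin n → Bool) → countF p ≤ n
countF≤n {zero}  p = z≤n
countF≤n {suc n} p = +-mono-≤ (indicator≤1 (p zero)) (countF≤n (p ∘ suc))

countF≡0⇒false : ∀ {n} (p : Fin n → Bool) → countF p ≡ 0 → ∀ {i} → p i ≢ true
countF≡0⇒false p c0 {i} e = n≮n 0 (subst (0 <_) c0 (countF-pos p i e))

countF-head+tail : ∀ {n} (p : Fin (suc n) → Bool) → p zero ≡ true → ∀ j → p (suc j) ≡ true → 2 ≤ countF p
countF-head+tail p p₀ j pj = +-mono-≤ (indicator-mono {true} {p zero} (λ _ → p₀)) (countF-pos (p ∘ suc) j pj)

countF≤1⇒unique : ∀ {n} (p : Fin n → Bool) → countF p ≤ 1 →
                  ∀ {i j} → p i ≡ true → p j ≡ true → i ≡ j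
countF≤1⇒unique {suc n} p h {zero}  {zero}  _  _  = refl
countF≤1⇒unique {suc n} p h {zero}  {suc j} pi pj = contradiction (≤-trans (countF-head+tail p pi j pj) h) 1+n≰n
countF≤1⇒unique {suc n} p h {suc i} {zero}  pi pj = contradiction (≤-trans (countF-head+tail p pj i pi) h) 1+n≰n
countF≤1⇒unique {suc n} p h {suc i} {suc j} pi pj =
  cong suc (countF≤1⇒unique (p ∘ suc) (≤-trans (m≤n+m _ (indicator (p zero))) h) pi pj)

-- Reachability along a Boolean relation is decidable: the set of vertices
-- reachable within k steps grows strictly until it is closed under the
-- relation, and it never has more than n elements.

module Reachability {n : ℕ} (R : Fin n → Fin n → Bool) (r : Fin n) where

  Edge : Fin n → Fin n → Set
  Edge a b = R a b ≡ true

  within : ℕ → Fin n → Bool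
  within zero    y = r == y
  within (suc k) y = within k y ∨ anyF (λ x → within k x ∧ R x y)

  within-sound : ∀ k {y} → within k y ≡ true → Star Edge r y
  within-sound zero    e = subst (Star Edge r) (==⇒≡ e) ε
  within-sound (suc k) {y} e with ∨-true⁻ {within k y} e
  ... | inj₁ e′ = within-sound k e′
  ... | inj₂ e′ with anyF-true⇒∃ _ e′
  ...   | x , e″ with within k x in wx | R x y in rxy
  ...     | true | true = within-sound k wx ◅◅ (rxy ◅ ε)

  within-suc : ∀ k y → within k y ≡ true → within (suc k) y ≡ true
  within-suc k y = ∨-trueˡ _

  within-root : ∀ k → within k r ≡ true
  within-root zero    = ≡⇒== refl
  within-root (suc k) = within-suc k r (within-root k)

  Closed : ℕ → Set
  Closed k = ∀ {x y} → within k x ≡ true → Edge x y → within k y ≡ true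

  closed⇒stable : ∀ k → Closed k → ∀ y → within (suc k) y ≡ true → within k y ≡ true
  closed⇒stable k cl y e with ∨-true⁻ {within k y} e
  ... | inj₁ e′ = e′
  ... | inj₂ e′ with anyF-true⇒∃ _ e′
  ...   | x , e″ with within k x in wx | R x y in rxy
  ...     | true | true = cl wx rxy

  stable⇒closed : ∀ k → (∀ y → within (suc k) y ≡ true → within k y ≡ true) → Closed k
  stable⇒closed k st {x} {y} wx rxy =
    st y (∨-trueʳ (within k y) (anyF-intro (λ x′ → within k x′ ∧ R x′ y) x (∧-intro wx rxy)))

  closed-suc : ∀ k → Closed k → Closed (suc k)
  closed-suc k cl {x} {y} wx rxy =
    within-suc k y (cl (closed⇒stable k cl x wx) rxy)

  closed-or-large : ∀ k → Closed k ⊎ k < countF (within k)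
  closed-or-large zero = inj₂ (countF-pos (within 0) r (within-root 0))
  closed-or-large (suc k) with closed-or-large k
  ... | inj₁ cl = inj₁ (closed-suc k cl)
  ... | inj₂ large
    with any? (λ y → (within (suc k) y ≟ᵇ true) ×-dec (within k y ≟ᵇ false))
  ...   | yes (y , new , old) =
          inj₂ (≤-trans (s≤s large) (countF-mono-< (within-suc k) y old new))
  ...   | no none = inj₁ (closed-suc k (stable⇒closed k stable))
    where
      stable : ∀ y → within (suc k) y ≡ true → within k y ≡ true
      stable y e with within k y ≟ᵇ true
      ... | yes old = old
      ... | no  new = contradiction (y , e , ¬-not new) none

  closed-n : Closed n
  closed-n = [ (λ cl → cl) , (λ large → contradiction (≤-trans large (countF≤n _)) 1+n≰n) ]′
             (closed-or-large n)

  within-complete : ∀ {x y} → within n x ≡ true → Star Edge x y → within n y ≡ true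
  within-complete wx ε          = wx
  within-complete wx (e ◅ path) = within-complete (closed-n wx e) path

  reachable? : ∀ y → Dec (Star Edge r y)
  reachable? y with within n y in wy
  ... | true  = yes (within-sound n wy)
  ... | false = no λ path → contradiction (trans (sym wy) (within-complete (within-root n) path)) λ ()

module _ {n : ℕ} (S : Digraph n) (a b : Fin n) where

  remove-false⇒removed : ∀ {s t} → remove S a b s t ≡ false → S s t ≡ true → a ≡ s × b ≡ t
  remove-false⇒removed {s} {t} e st with S s t | a == s in as | b == t in bt
  ... | true  | true  | true  = ==⇒≡ as , ==⇒≡ bt
  ... | true  | true  | false = contradiction e λ ()
  ... | true  | false | _     = contradiction e λ ()
  ... | false | _     | _     = contradiction st λ ()

  incident-remove-false : ∀ {s} → incident (remove S a b) s ≡ false →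
    (∀ {t} → S s t ≡ true → a ≡ s × b ≡ t) × (∀ {t} → S t s ≡ true → a ≡ t × b ≡ s)
  incident-remove-false {s} e =
    (λ {t} st → remove-false⇒removed (∨-conicalˡ _ _ (no-edge t)) st) ,
    (λ {t} ts → remove-false⇒removed (∨-conicalʳ _ _ (no-edge t)) ts)
    where
      no-edge : ∀ t → (remove S a b s t ∨ remove S a b t s) ≡ false
      no-edge = anyF-false⇒ _ e

  incident-remove⇒incident : ∀ {s} → incident (remove S a b) s ≡ true → incident S s ≡ true
  incident-remove⇒incident {s} e with anyF-true⇒∃ _ e
  ... | t , e′ = anyF-intro _ t (
    [ (λ st → ∨-trueˡ (S t s) (∧-true⁻ˡ {S s t} st)) , (λ ts → ∨-trueʳ (S s t) (∧-true⁻ˡ {S t s} ts)) ]′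
    (∨-true⁻ {remove S a b s t} e′))

incident⇒edge : ∀ {n} (S : Digraph n) {s} → incident S s ≡ true → ∃[ t ] (S s t ≡ true ⊎ S t s ≡ true)
incident⇒edge S e with anyF-true⇒∃ _ e
... | t , e′ = t , ∨-true⁻ e′

record DegreeAtMostOne {n : ℕ} (C : Digraph n) : Set where
  field
    out-unique : ∀ {v a b} → C v a ≡ true → C v b ≡ true → a ≡ b
    in-unique  : ∀ {v a b} → C a v ≡ true → C b v ≡ true → a ≡ b

module _ {n : ℕ} (C : Digraph n) (a b c d : Fin n) where

  replace-true⁻ : ∀ {x y} → replace C a b c d x y ≡ true →
                  (C x y ≡ true × ¬ (a ≡ x × b ≡ y)) ⊎ (c ≡ x × d ≡ y)
  replace-true⁻ {x} {y} e with ∨-true⁻ {C x y ∧ not ((a == x) ∧ (b == y))} e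
  ... | inj₂ new = inj₂ (==⇒≡ (∧-true⁻ˡ new) , ==⇒≡ (∧-true⁻ʳ new))
  ... | inj₁ old = inj₁ (∧-true⁻ˡ old , λ (ax , by) →
          contradiction (∧-intro (≡⇒== ax) (≡⇒== by)) (¬-not-true (∧-true⁻ʳ old)))

  replace-degree : DegreeAtMostOne C →
    (∀ {y} → C c y ≡ true → a ≡ c × b ≡ y) → (∀ {x} → C x d ≡ true → a ≡ x × b ≡ d) →
    DegreeAtMostOne (replace C a b c d)
  replace-degree deg out-c in-d = record { out-unique = out ; in-unique = inn }
    where
      open DegreeAtMostOne deg
      out : ∀ {v s t} → replace C a b c d v s ≡ true → replace C a b c d v t ≡ true → s ≡ t
      out e₁ e₂ with replace-true⁻ e₁ | replace-true⁻ e₂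
      ... | inj₁ (cs , _)       | inj₁ (ct , _)       = out-unique cs ct
      ... | inj₁ (cs , fresh)   | inj₂ (refl , refl)  = contradiction (out-c cs) fresh
      ... | inj₂ (refl , refl)  | inj₁ (ct , fresh)   = contradiction (out-c ct) fresh
      ... | inj₂ (_ , ds)       | inj₂ (_ , dt)       = trans (sym ds) dt
      inn : ∀ {v s t} → replace C a b c d s v ≡ true → replace C a b c d t v ≡ true → s ≡ t
      inn e₁ e₂ with replace-true⁻ e₁ | replace-true⁻ e₂
      ... | inj₁ (cs , _)       | inj₁ (ct , _)       = in-unique cs ct
      ... | inj₁ (cs , fresh)   | inj₂ (refl , refl)  = contradiction (in-d cs) fresh
      ... | inj₂ (refl , refl)  | inj₁ (ct , fresh)   = contradiction (in-d ct) fresh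
      ... | inj₂ (cs , _)       | inj₂ (ct , _)       = trans (sym cs) ct

degree-resp-≗₂ : ∀ {n} {C D : Digraph n} → C ≗₂ D → DegreeAtMostOne D → DegreeAtMostOne C
degree-resp-≗₂ {C = C} eq deg = record
  { out-unique = λ {v} {a} {b} e₁ e₂ → out-unique (trans (sym (eq v a)) e₁) (trans (sym (eq v b)) e₂)
  ; in-unique  = λ {v} {a} {b} e₁ e₂ → in-unique (trans (sym (eq a v)) e₁) (trans (sym (eq b v)) e₂)
  }
  where open DegreeAtMostOne deg

cstep-degree : ∀ {n} {G C C′ : Digraph n} → CStep G C C′ → DegreeAtMostOne C → DegreeAtMostOne C′
cstep-degree {C = C} (fwd u v w _ _ no-out _ wv eq) deg =
  degree-resp-≗₂ eq (replace-degree C w v u v deg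
    (λ uy → contradiction uy (countF≡0⇒false (C u) no-out))
    (λ xv → in-unique wv xv , refl))
  where open DegreeAtMostOne deg
cstep-degree {C = C} (bwd u v w _ _ no-in _ uw eq) deg =
  degree-resp-≗₂ eq (replace-degree C u w u v deg
    (λ uy → refl , out-unique uw uy)
    (λ xv → contradiction xv (countF≡0⇒false (λ x → C x v) no-in)))
  where open DegreeAtMostOne deg

cover-steps-degree : ∀ {n} {G C C′ : Digraph n} → Star (CStep G) C C′ → DegreeAtMostOne C → DegreeAtMostOne C′
cover-steps-degree ε              deg = deg
cover-steps-degree (step ◅ steps) deg = cover-steps-degree steps (cstep-degree step deg)

pcc-degree : ∀ {n} {H : Fin n → Fin n → Set} {C : Digraph n} → IsPCC H C → DegreeAtMostOne C
pcc-degree {C = C} (_ , out≤1 , in≤1) = record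
  { out-unique = λ {v} → countF≤1⇒unique (C v) (out≤1 v)
  ; in-unique  = λ {v} → countF≤1⇒unique (λ u → C u v) (in≤1 v)
  }

pruning-⊆ : ∀ {n} {C M₀ M : Digraph n} → Star (MStep C) M₀ M → ∀ {a b} → M a b ≡ true → M₀ a b ≡ true
pruning-⊆ ε                              e = e
pruning-⊆ (prune x y _ eq _ ◅ steps) {a} {b} e = ∧-true⁻ˡ (trans (sym (eq a b)) (pruning-⊆ steps e))

module Pendants {n : ℕ} (C M : Digraph n) (deg : DegreeAtMostOne C)
  (M-separated : ∀ {a b} → M a b ≡ true → ¬ SameComp C a b)
  (M-minimal : ∀ M′ → ¬ MStep C M M′) where

  open DegreeAtMostOne deg

  Same : Fin n → Fin n → Set
  Same = SameComp C

  same-sym : ∀ {a b} → Same a b → Same b a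
  same-sym = reverse Sum.swap

  edge-same : ∀ {a b} → C a b ≡ true → Same a b
  edge-same e = inj₁ e ◅ ε

  same? : ∀ a b → Dec (Same a b)
  same? a b with Reachability.reachable? (λ x y → C x y ∨ C y x) a b
  ... | yes path = yes (Star-map (λ {x} → ∨-true⁻ {C x _}) path)
  ... | no ¬path = no (¬path ∘ Star-map [ ∨-trueˡ _ , ∨-trueʳ _ ]′)

  OnPair : Fin n → Fin n → Fin n → Set
  OnPair x y s = s ≡ x ⊎ s ≡ y

  -- Because degrees are at most one, a 2-cycle is a whole component of C.
  module TwoCycle {x y : Fin n} (cxy : C x y ≡ true) (cyx : C y x ≡ true) where

    on-step : ∀ {s t} → OnPair x y s → (C s t ≡ true ⊎ C t s ≡ true) → OnPair x y t
    on-step (inj₁ refl) (inj₁ e) = inj₂ (out-unique e cxy)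
    on-step (inj₁ refl) (inj₂ e) = inj₂ (in-unique e cyx)
    on-step (inj₂ refl) (inj₁ e) = inj₁ (out-unique e cyx)
    on-step (inj₂ refl) (inj₂ e) = inj₁ (in-unique e cxy)

    on-closed : ∀ {s t} → OnPair x y s → Same s t → OnPair x y t
    on-closed os ε          = os
    on-closed os (e ◅ path) = on-closed (on-step os e) path

    on-2cycle : ∀ {s} → OnPair x y s → In2Cycle C s
    on-2cycle (inj₁ refl) = y , cxy , cyx
    on-2cycle (inj₂ refl) = x , cyx , cxy

    on-same : ∀ {s t} → OnPair x y s → OnPair x y t → Same s t
    on-same os ot = same-sym (from-x os) ◅◅ from-x ot
      where
        from-x : ∀ {s} → OnPair x y s → Same x s
        from-x (inj₁ refl) = ε
        from-x (inj₂ refl) = edge-same cxy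

  in2cycle-resp : ∀ {v v′} → In2Cycle C v → Same v v′ → In2Cycle C v′
  in2cycle-resp (_ , cvy , cyv) path = on-2cycle (on-closed (inj₁ refl) path)
    where open TwoCycle cvy cyv

  MEdge : Fin n → Fin n → Set
  MEdge s t = M s t ≡ true ⊎ M t s ≡ true

  MEdge-separated : ∀ {s t} → MEdge s t → ¬ Same s t
  MEdge-separated (inj₁ e) = M-separated e
  MEdge-separated (inj₂ e) = M-separated e ∘ same-sym

  record Hangs (a b : Fin n) : Set where
    field
      x y    : Fin n
      cxy    : C x y ≡ true
      cyx    : C y x ≡ true
      on-a   : OnPair x y a
      only-b : ∀ {s t} → OnPair x y s → MEdge s t → t ≡ b

  sole-edge⇒hangs : ∀ {a b x y} (cxy : C x y ≡ true) (cyx : C y x ≡ true) →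
    (∀ {s t} → OnPair x y s → MEdge s t → (a ≡ s × b ≡ t) ⊎ (a ≡ t × b ≡ s)) →
    OnPair x y a → Hangs a b
  sole-edge⇒hangs {a} {b} {x} {y} cxy cyx sole on-a = record
    { x = x ; y = y ; cxy = cxy ; cyx = cyx ; on-a = on-a ; only-b = only-b }
    where
      open TwoCycle cxy cyx
      only-b : ∀ {s t} → OnPair x y s → MEdge s t → t ≡ b
      only-b os e with sole os e
      ... | inj₁ (_ , b≡t)    = sym b≡t
      ... | inj₂ (refl , _)   = contradiction (on-same os on-a) (MEdge-separated e)

  -- M admits no pruning step, so deleting any of its edges lowers the weight.
  weight-drop : ∀ {a b} → M a b ≡ true → ∃[ x ] ∃[ y ] C x y ≡ true × C y x ≡ true
    × (incident (remove M a b) x ∨ incident (remove M a b) y) ≡ false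
    × (incident M x ∨ incident M y) ≡ true
  weight-drop {a} {b} e
    with countF-≢⇒∃≢ (M-minimal (remove M a b) ∘ prune a b e (λ _ _ → refl))
  ... | x , dx with anyF-≢⇒∃≢ dx
  ... | y , dxy with ∧-≢⇒true×≢ (C x y) dxy
  ... | cxy , d₁ with ∧-≢⇒true×≢ (C y x) d₁
  ... | cyx , d₂ with ∧-≢⇒true×≢ _ d₂
  ... | _ , d₃ with ⇒-≢⇒false×true saturation-mono d₃
    where
      saturation-mono : (incident (remove M a b) x ∨ incident (remove M a b) y) ≡ true →
                        (incident M x ∨ incident M y) ≡ true
      saturation-mono e′ = [ ∨-trueˡ _ ∘ incident-remove⇒incident M a b
                           , ∨-trueʳ _ ∘ incident-remove⇒incident M a b ]′
                           (∨-true⁻ {incident (remove M a b) x} e′)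
  ... | unsat , sat = x , y , cxy , cyx , unsat , sat

  saturated⇒touched : ∀ {x y} → (incident M x ∨ incident M y) ≡ true → ∃[ s ] ∃[ t ] OnPair x y s × MEdge s t
  saturated⇒touched {x} {y} sat with ∨-true⁻ {incident M x} sat
  ... | inj₁ sx = x , Prod.map₂ (inj₁ refl ,_) (incident⇒edge M sx)
  ... | inj₂ sy = y , Prod.map₂ (inj₂ refl ,_) (incident⇒edge M sy)

  unsaturated⇒sole : ∀ {a b x y} → (incident (remove M a b) x ∨ incident (remove M a b) y) ≡ false →
    ∀ {s t} → OnPair x y s → MEdge s t → (a ≡ s × b ≡ t) ⊎ (a ≡ t × b ≡ s)
  unsaturated⇒sole {a} {b} {x} {y} unsat {s} os = Sum.map (proj₁ only) (proj₂ only)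
    where
      only : (∀ {t} → M s t ≡ true → a ≡ s × b ≡ t) × (∀ {t} → M t s ≡ true → a ≡ t × b ≡ s)
      only = incident-remove-false M a b
        ([ (λ { refl → ∨-conicalˡ _ _ unsat }) , (λ { refl → ∨-conicalʳ _ _ unsat }) ]′ os)

  sole-edge⇒hangs⊎ : ∀ {a b x y} (cxy : C x y ≡ true) (cyx : C y x ≡ true) →
    (∀ {s t} → OnPair x y s → MEdge s t → (a ≡ s × b ≡ t) ⊎ (a ≡ t × b ≡ s)) →
    ∀ {s t} → OnPair x y s → MEdge s t → Hangs a b ⊎ Hangs b a
  sole-edge⇒hangs⊎ {a} {b} {x} {y} cxy cyx sole os st with sole os st
  ... | inj₁ (refl , _) = inj₁ (sole-edge⇒hangs cxy cyx sole os)
  ... | inj₂ (_ , refl) = inj₂ (sole-edge⇒hangs cxy cyx sole′ os)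
    where
      sole′ : ∀ {s t} → OnPair x y s → MEdge s t → (b ≡ s × a ≡ t) ⊎ (b ≡ t × a ≡ s)
      sole′ os′ st′ = Sum.swap (Sum.map Prod.swap Prod.swap (sole os′ st′))

  M-edge-hangs : ∀ {a b} → M a b ≡ true → Hangs a b ⊎ Hangs b a
  M-edge-hangs e =
    let (x , y , cxy , cyx , unsat , sat) = weight-drop e
        (s , t , os , st) = saturated⇒touched sat
    in sole-edge⇒hangs⊎ cxy cyx (unsaturated⇒sole unsat) os st

  MEdge⇒hangs : ∀ {a b} → MEdge a b → Hangs a b ⊎ Hangs b a
  MEdge⇒hangs (inj₁ e) = M-edge-hangs e
  MEdge⇒hangs (inj₂ e) = Sum.swap (M-edge-hangs e)

  Adj : Fin n → Fin n → Set
  Adj = Adj3 C M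

  Conn : Fin n → Fin n → Set
  Conn = Conn3 C M

  adj-sym : ∀ {u w} → Adj u w → Adj w u
  adj-sym (nuw , s , t , us , wt , e) = nuw ∘ same-sym , t , s , wt , us , Sum.swap e

  adj-respˡ : ∀ {u u′ w} → Same u u′ → Adj u w → Adj u′ w
  adj-respˡ uu′ (nuw , s , t , us , wt , e) = nuw ∘ (uu′ ◅◅_) , s , t , same-sym uu′ ◅◅ us , wt , e

  conn-sym : ∀ {u w} → Conn u w → Conn w u
  conn-sym = reverse (Sum.map same-sym adj-sym)

  adj⇒MEdge : ∀ {u w} → Adj u w → ∃[ s ] ∃[ t ] Same u s × Same w t × MEdge s t
  adj⇒MEdge (nuw , s , t , us , wt , inj₁ e) with ∨-true⁻ {C s t} e
  ... | inj₁ c = contradiction (us ◅◅ edge-same c ◅◅ same-sym wt) nuw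
  ... | inj₂ m = s , t , us , wt , inj₁ m
  adj⇒MEdge (nuw , s , t , us , wt , inj₂ e) with ∨-true⁻ {C t s} e
  ... | inj₁ c = contradiction (us ◅◅ same-sym (edge-same c) ◅◅ same-sym wt) nuw
  ... | inj₂ m = s , t , us , wt , inj₂ m

  MEdge⇒adj : ∀ {s t u w} → MEdge s t → Same u s → Same w t → Adj u w
  MEdge⇒adj {s} {t} e us wt =
    (λ uw → MEdge-separated e (same-sym us ◅◅ uw ◅◅ wt)) ,
    s , t , us , wt , Sum.map (∨-trueʳ (C s t)) (∨-trueʳ (C t s)) e

  Pendant : Fin n → Fin n → Set
  Pendant p q = In2Cycle C p × (∀ {w} → Adj p w → Same w q)

  pendant-respˡ : ∀ {p p′ q} → Same p p′ → Pendant p q → Pendant p′ q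
  pendant-respˡ pp′ (two , only) = in2cycle-resp two pp′ , λ adj → only (adj-respˡ (same-sym pp′) adj)

  hangs⇒pendant : ∀ {a b u w} → Hangs a b → Same u a → Same w b → Pendant u w
  hangs⇒pendant {a} {b} {u} {w} h ua wb = on-2cycle on-u , only-w
    where
      open Hangs h
      open TwoCycle cxy cyx
      on-u : OnPair x y u
      on-u = on-closed on-a (same-sym ua)
      only-w : ∀ {w′} → Adj u w′ → Same w′ w
      only-w {w′} adj =
        let (s , t , us , w′t , e) = adj⇒MEdge adj
        in subst (Same w′) (only-b (on-closed on-u us) e) w′t ◅◅ same-sym wb

  adj⇒pendant : ∀ {u w} → Adj u w → Pendant u w ⊎ Pendant w u
  adj⇒pendant adj =
    let (s , t , us , wt , e) = adj⇒MEdge adj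
    in Sum.map (λ h → hangs⇒pendant h us wt) (λ h → hangs⇒pendant h wt us) (MEdge⇒hangs e)

  pendant-deg1 : ∀ {v q} → Pendant v q → Adj v q → Deg1 C M v
  pendant-deg1 (_ , only) vq = (_ , vq) , λ _ _ vw vw′ → only vw ◅◅ same-sym (only vw′)

  -- The component of a pendant edge p – q of G₃ is a star centred at q.
  AtCenter : Fin n → Fin n → Set
  AtCenter q v = Same v q ⊎ (Pendant v q × Adj v q)

  at-center-step : ∀ {p q} → Pendant p q → Adj p q →
                   ∀ {v v′} → AtCenter q v → (Same v v′ ⊎ Adj v v′) → AtCenter q v′
  at-center-step _ _ (inj₁ vq) (inj₁ vv′) = inj₁ (same-sym vv′ ◅◅ vq)
  at-center-step p-pend pq (inj₁ vq) (inj₂ vv′) with adj⇒pendant (adj-respˡ vq vv′)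
  ... | inj₁ (_ , only) = let pv′ = only (adj-sym pq) in inj₂ (pendant-respˡ pv′ p-pend , adj-respˡ pv′ pq)
  ... | inj₂ v′-pend    = inj₂ (v′-pend , adj-sym (adj-respˡ vq vv′))
  at-center-step _ _ (inj₂ (v-pend , vq)) (inj₁ vv′) = inj₂ (pendant-respˡ vv′ v-pend , adj-respˡ vv′ vq)
  at-center-step _ _ (inj₂ ((_ , only) , _)) (inj₂ vv′) = inj₁ (only vv′)

  at-center-closed : ∀ {p q} → Pendant p q → Adj p q → ∀ {v v′} → AtCenter q v → Conn v v′ → AtCenter q v′
  at-center-closed p-pend pq at ε          = at
  at-center-closed p-pend pq at (e ◅ path) = at-center-closed p-pend pq (at-center-step p-pend pq at e) path

  pendant-star : ∀ {p q} → Pendant p q → Adj p q → ∀ {v} → Conn p v → ¬ Same v q → Deg1 C M v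
  pendant-star p-pend pq pv ¬vq with at-center-closed p-pend pq (inj₂ (p-pend , pq)) pv
  ... | inj₁ vq             = contradiction vq ¬vq
  ... | inj₂ (v-pend , vq)  = pendant-deg1 v-pend vq

  pendant-pair : ∀ {v w} → Pendant w v → Adj w v → (∀ x y → Adj v x → Adj v y → Same x y) →
                 ∀ {u} → Conn w u → Same u v ⊎ Same u w
  pendant-pair w-pend wv unique wu with at-center-closed w-pend wv (inj₂ (w-pend , wv)) wu
  ... | inj₁ uv       = inj₁ uv
  ... | inj₂ (_ , uv) = inj₂ (unique _ _ (adj-sym uv) (adj-sym wv))

  no-three-in-two : ∀ {a b c v w} → ¬ Same a b → ¬ Same a c → ¬ Same b c →
    Same a v ⊎ Same a w → Same b v ⊎ Same b w → Same c v ⊎ Same c w → ⊥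
  no-three-in-two ¬ab _ _ (inj₁ av) (inj₁ bv) _ = ¬ab (av ◅◅ same-sym bv)
  no-three-in-two ¬ab _ _ (inj₂ aw) (inj₂ bw) _ = ¬ab (aw ◅◅ same-sym bw)
  no-three-in-two _ ¬ac _ (inj₁ av) (inj₂ _) (inj₁ cv) = ¬ac (av ◅◅ same-sym cv)
  no-three-in-two _ _ ¬bc (inj₁ _) (inj₂ bw) (inj₂ cw) = ¬bc (bw ◅◅ same-sym cw)
  no-three-in-two _ _ ¬bc (inj₂ _) (inj₁ bv) (inj₁ cv) = ¬bc (bv ◅◅ same-sym cv)
  no-three-in-two _ ¬ac _ (inj₂ aw) (inj₁ _) (inj₂ cw) = ¬ac (aw ◅◅ same-sym cw)

  adjacent-along : ∀ {a b} → Conn a b → ¬ Same a b → ∃[ u ] ∃[ u′ ] Conn a u × Adj u u′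
  adjacent-along ε                 ¬ab = contradiction ε ¬ab
  adjacent-along (inj₁ aa′ ◅ path) ¬ab =
    Prod.map₂ (Prod.map₂ (Prod.map₁ (inj₁ aa′ ◅_))) (adjacent-along path (¬ab ∘ (aa′ ◅◅_)))
  adjacent-along (inj₂ aa′ ◅ path) _ = _ , _ , ε , aa′

  MEdge? : ∀ s t → Dec (MEdge s t)
  MEdge? s t = (M s t ≟ᵇ true) ⊎-dec (M t s ≟ᵇ true)

  isolated-or-adjacent : ∀ r → Deg0 C M r ⊎ ∃[ w ] Adj r w
  isolated-or-adjacent r with any? (λ s → any? (λ t → same? r s ×-dec MEdge? s t))
  ... | yes (s , t , rs , e) = inj₂ (t , MEdge⇒adj e rs ε)
  ... | no none = inj₁ λ w rw → let (s , t , rs , _ , e) = adj⇒MEdge rw in none (s , t , rs , e)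

  isolated-or-star : ∀ r → IsolatedH C M r ⊎ StarH C M r
  isolated-or-star r with isolated-or-adjacent r
  ... | inj₁ isolated = inj₁ isolated
  ... | inj₂ (w , rw) with adj⇒pendant rw
  ...   | inj₁ r-pend = inj₂ ((r , w , ε , rw) , w , inj₂ rw ◅ ε , λ _ → pendant-star r-pend rw)
  ...   | inj₂ w-pend = inj₂ ((r , w , ε , rw) , r , ε ,
                               λ _ rv → pendant-star w-pend (adj-sym rw) (inj₂ (adj-sym rw) ◅ rv))

  satellites-are-2cycles : ∀ r → AtLeast3H C M r → ∀ v → Conn r v → Deg1 C M v → In2Cycle C v
  satellites-are-2cycles r (a , b , c , ra , rb , rc , ¬ab , ¬ac , ¬bc) v rv ((w , vw) , unique)
    with adj⇒pendant vw
  ... | inj₁ (v-2cycle , _) = v-2cycle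
  ... | inj₂ w-pend = ⊥-elim (no-three-in-two ¬ab ¬ac ¬bc (side ra) (side rb) (side rc))
    where
      side : ∀ {u} → Conn r u → Same u v ⊎ Same u w
      side ru = pendant-pair w-pend (adj-sym vw) unique (inj₂ (adj-sym vw) ◅ conn-sym rv ◅◅ ru)

  pair-has-2cycle : ∀ r a b → Exactly2H C M r a b → In2Cycle C a ⊎ In2Cycle C b
  pair-has-2cycle r a b (ra , rb , ¬ab , covered) with adjacent-along (conn-sym ra ◅◅ rb) ¬ab
  ... | u , u′ , au , uu′ =
    [ in-pair (ra ◅◅ au) ∘ proj₁ , in-pair (ra ◅◅ au ◅◅ inj₂ uu′ ◅ ε) ∘ proj₁ ]′ (adj⇒pendant uu′)
    where
      in-pair : ∀ {p} → Conn r p → In2Cycle C p → In2Cycle C a ⊎ In2Cycle C b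
      in-pair rp p-2cycle = Sum.map (in2cycle-resp p-2cycle) (in2cycle-resp p-2cycle) (covered _ rp)

fact1 : (n : ℕ) (G : Digraph n) → Loopless G → (k : ℕ) → 7 ≤ k →
        (C M : Digraph n) → IsFinalCover G C → IsFinalM G C M →
        (r : Fin n) →
          (IsolatedH C M r ⊎ StarH C M r)
        × (AtLeast3H C M r → (v : Fin n) → Conn3 C M r v → Deg1 C M v → In2Cycle C v)
        × ((a b : Fin n) → Exactly2H C M r a b → In2Cycle C a ⊎ In2Cycle C b)
fact1 _ _ _ _ _ C M ((C₀ , (C₀-pcc , _) , steps) , _) ((M₀ , ((M₀-in-E₁ , _) , _) , prunes) , minimal) r =
  isolated-or-star r , satellites-are-2cycles r , pair-has-2cycle r
  where
    separated : ∀ {a b} → M a b ≡ true → ¬ SameComp C a b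
    separated {a} {b} e = proj₁ (proj₂ (proj₂ (M₀-in-E₁ a b (pruning-⊆ prunes e))))

    open Pendants C M (cover-steps-degree steps (pcc-degree C₀-pcc)) separated minimal
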